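{- Let $\delta \geq 2$. If $Q$ is a $\delta$-colourable quadruple system of order $v$, then there is a $K(Q)$ which is a $2\delta$-colourable Kirkman triple system of order $2v+1$.
   Context: A quadruple system of order $v$ is a set of $v$ points with a set of $4$-subsets (blocks) such that each pair of points lies in exactly one block. Given a quadruple system $Q$ on points $\{q_0,\dots,q_{v-1}\}$, a $K(Q)$ is a Kirkman triple system (Steiner triple system with a partition of its triples into parallel classes) on $\{\infty\}\cup\{q_i,q_i' : 0\le i\le v-1\}$ obtained by placing, for each block $\{w,x,y,z\}$ of $Q$, the triples of a KTS$(9)$ on $\{\infty,w,x,y,z,w',x',y',z'\}$ so that the triples containing $\infty$ are $\{\infty,w,w'\},\{\infty,x,x'\},\{\infty,y,y'\},\{\infty,z,z'\}$ (the placement is not unique). A design is $\delta$-colourable if there is a map from its points to a set of $\delta$ colours with no monochromatic block. -}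

module Defs where

open import Data.Nat using (ℕ; suc; _+_)
open import Data.Fin using (Fin; zero; suc; _↑ˡ_; _↑ʳ_)
open import Data.Fin.Subset using (Subset; ⊤; inside; outside; _∈_; _∉_; _⊆_; ∣_∣; ⁅_⁆; _∪_)
open import Data.Vec using (_∷_; _++_)
open import Data.List using (List; length; lookup)
import Data.List.Membership.Propositional as L
open import Data.Product using (Σ; _×_; ∃; ∃-syntax)
open import Relation.Binary.PropositionalEquality using (_≡_; _≢_)
open import Relation.Nullary using (¬_)
open import Function.Bundles using (_⇔_)

ExactlyOne : {m : ℕ} → (Fin m → Set) → Set
ExactlyOne {m} P = Σ (Fin m) λ i → P i × (∀ j → P j → j ≡ i)

record IsDesignOn {n : ℕ} (S : Subset n) (k : ℕ) (B : List (Subset n)) : Set where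
  field
    blockSize : ∀ (i : Fin (length B)) → ∣ lookup B i ∣ ≡ k
    blockInS  : ∀ (i : Fin (length B)) → lookup B i ⊆ S
    pairs     : ∀ (x y : Fin n) → x ∈ S → y ∈ S → x ≢ y →
                ExactlyOne (λ (i : Fin (length B)) → (x ∈ lookup B i) × (y ∈ lookup B i))

IsQS : (v : ℕ) → List (Subset v) → Set
IsQS v B = IsDesignOn {v} ⊤ 4 B

IsResolutionOn : {n : ℕ} (S : Subset n) (T : List (Subset n)) → Set
IsResolutionOn {n} S T =
  ∃[ m ] Σ (Fin (length T) → Fin m) λ cls →
    ∀ (r : Fin m) (p : Fin n) → p ∈ S →
      ExactlyOne (λ (t : Fin (length T)) → (cls t ≡ r) × (p ∈ lookup T t))

IsKTSOn : {n : ℕ} (S : Subset n) (T : List (Subset n)) → Set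
IsKTSOn S T = IsDesignOn S 3 T × IsResolutionOn S T

Monochromatic : {n δ : ℕ} → (Fin n → Fin δ) → Subset n → Set
Monochromatic {n} c b = ∃[ col ] (∀ (x : Fin n) → x ∈ b → c x ≡ col)

Colourable : {n : ℕ} (δ : ℕ) → List (Subset n) → Set
Colourable {n} δ B = Σ (Fin n → Fin δ) λ c →
  ∀ (i : Fin (length B)) → ¬ Monochromatic c (lookup B i)

IsKTS : (n : ℕ) → List (Subset n) → Set
IsKTS n T = IsKTSOn {n} ⊤ T

∞pt : (v : ℕ) → Fin (suc (v + v))
∞pt v = zero

qpt : (v : ℕ) → Fin v → Fin (suc (v + v))
qpt v i = suc (i ↑ˡ v)

q'pt : (v : ℕ) → Fin v → Fin (suc (v + v))
q'pt v i = suc (v ↑ʳ i)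

-- The 9-set {∞, w, x, y, z, w', x', y', z'} of a block b of Q.
nine : (v : ℕ) → Subset v → Subset (suc (v + v))
nine v b = inside ∷ (b ++ b)

∞triple : (v : ℕ) → Fin v → Subset (suc (v + v))
∞triple v w = ⁅ ∞pt v ⁆ ∪ (⁅ qpt v w ⁆ ∪ ⁅ q'pt v w ⁆)

IsKQ : (v : ℕ) (QB : List (Subset v)) (T : List (Subset (suc (v + v)))) → Set
IsKQ v QB T =
  Σ (Fin (length QB) → List (Subset (suc (v + v)))) λ Tb →
    (∀ (b : Fin (length QB)) →
        IsKTSOn (nine v (lookup QB b)) (Tb b)
      × (∀ (w : Fin v) → w ∈ lookup QB b → ∞triple v w L.∈ Tb b)
      × (∀ (t : Subset (suc (v + v))) → t L.∈ Tb b → ∞pt v ∈ t →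
           ∃[ w ] (w ∈ lookup QB b × t ≡ ∞triple v w)))
    × (∀ (t : Subset (suc (v + v))) →
         t L.∈ T ⇔ (∃[ b ] (t L.∈ Tb b)))

-- Every block {w,x,y,z} of Q carries a copy of AG(2,3), the KTS(9) on
-- {∞,w,x,y,z,w′,x′,y′,z′}, whose four parallel classes are indexed by the
-- block points: the class of w is {∞,w,w′} together with two lines avoiding w
-- and w′.  Since every pair of points of Q lies in exactly one block, these
-- copies glue to a KTS(2v+1), and its parallel class w consists of {∞,w,w′}
-- and, for every block through w, that block's two other lines of class w.
-- Colour q_i by the colour of i in a first palette, q′_i by the colour of i in
-- a second palette, and ∞ arbitrarily.  A triple meeting both q and q′ is then
-- not monochromatic, and in the chosen AG(2,3) the only other lines are
-- {x,y,z} and {x′,y′,z′} for one block point w.  Labelling every block so that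
-- its points other than w are not monochromatic, which is possible because the
-- block itself is not, makes every triple non-monochromatic.

module Submission where

open import Defs
open import Data.Empty using (⊥-elim)
open import Data.Fin using (Fin; zero; suc; _↑ˡ_; splitAt; join; cast)
open import Data.Fin.Patterns using (0F; 1F; 2F; 3F)
open import Data.Fin.Permutation using (Permutation′; _⟨$⟩ʳ_; _⟨$⟩ˡ_; inverseˡ; inverseʳ; transpose)
open import Data.Fin.Properties
  using (_≟_; any?; all?; ¬Fin0; ↑ˡ-injective; splitAt-join; join-splitAt; suc-injective; +↔⊎; *↔×; cast-involutive)
open import Data.Fin.Subset using (Subset; inside; outside; _∈_; _∉_; _⊆_; ∣_∣; ⁅_⁆; _∪_)
open import Data.Fin.Subset.Properties using (∈⊤; x∈p∪q⁻; x∈p∪q⁺; x∈⁅x⁆; x∈⁅y⁆⇒x≡y; ∣⁅x⁆∣≡1; ∪-identityˡ)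
open import Data.List using (List; length; lookup; tabulate)
open import Data.List.Properties using (length-tabulate; lookup-tabulate)
import Data.List.Membership.Propositional as L
open import Data.List.Membership.Propositional.Properties using (∈-lookup)
open import Data.List.Relation.Unary.Any using (index)
open import Data.List.Relation.Unary.Any.Properties using (lookup-index)
open import Data.Nat using (ℕ; suc; _+_; _*_; _≤_; s≤s)
open import Data.Product as Product using (Σ; _×_; _,_; ∃; ∃!; proj₁; proj₂)
open import Data.Product.Function.NonDependent.Propositional using (_×-↔_)
open import Data.Sum as Sum using (_⊎_; inj₁; inj₂; [_,_]; reduce)
open import Data.Sum.Function.Propositional using (_⊎-↔_)
open import Data.Sum.Properties using (inj₁-injective; inj₂-injective; ≡-dec)
open import Data.Vec using ([]; _∷_; _++_; here; there)
open import Data.Vec.Properties using (lookup-++ˡ; lookup-++ʳ; []=⇒lookup; lookup⇒[]=)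
open import Function using (_∘_; id)
open import Function.Bundles using (Inverse; _↔_; _⇔_; mk⇔; mk↔ₛ′)
open import Function.Definitions using (Injective)
open import Function.Properties.Inverse using (↔-refl; ↔-sym; ↔-trans)
open import Relation.Binary.PropositionalEquality using (_≡_; _≢_; refl; sym; trans; cong; cong₂; subst)
open import Relation.Nullary using (¬_; Dec; yes; no)
open import Relation.Nullary.Decidable using (map′; _×-dec_; _⊎-dec_; _→-dec_; ¬?; toWitness)
open import Relation.Unary using (Decidable)

private
  variable
    m n : ℕ
    A B : Set

∃!⇒ExactlyOne : {P : Fin m → Set} → ∃! _≡_ P → ExactlyOne P
∃!⇒ExactlyOne (i , pᵢ , unique) = i , pᵢ , λ j pⱼ → sym (unique pⱼ)

∃!-map : {P Q : A → Set} → (∀ {a} → P a → Q a) → (∀ {a} → Q a → P a) → ∃! _≡_ P → ∃! _≡_ Q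
∃!-map f g (a , pₐ , unique) = a , f pₐ , λ q → unique (g q)

∀-↔ : (e : A ↔ B) {P : B → Set} → (∀ a → P (Inverse.to e a)) → ∀ b → P b
∀-↔ e {P} h b = subst P (strictlyInverseˡ b) (h (from b))
  where open Inverse e

∃!-↔ : (e : A ↔ B) {P : B → Set} → ∃! _≡_ (P ∘ Inverse.to e) → ∃! _≡_ P
∃!-↔ e {P} (a , pₐ , unique) =
  to a , pₐ , λ {b} p → trans (cong to (unique (subst P (sym (strictlyInverseˡ b)) p))) (strictlyInverseˡ b)
  where open Inverse e

∃!-↔⁻ : (e : A ↔ B) {P : B → Set} → ∃! _≡_ P → ∃! _≡_ (P ∘ Inverse.to e)
∃!-↔⁻ e {P} =
  ∃!-↔ (↔-sym e) ∘ ∃!-map (λ {b} → subst P (sym (strictlyInverseˡ b))) (λ {b} → subst P (strictlyInverseˡ b))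
  where open Inverse e

∀? : (e : Fin n ↔ A) {P : A → Set} → Decidable P → Dec (∀ a → P a)
∀? e P? = map′ (∀-↔ e) (λ h → h ∘ Inverse.to e) (all? (P? ∘ Inverse.to e))

∃!? : (e : Fin n ↔ A) {P : A → Set} → Decidable P → Dec (∃! _≡_ P)
∃!? e {P} P? = map′ (∃!-↔ e ∘ implicit) (explicit ∘ ∃!-↔⁻ e)
  (any? λ i → P? (to i) ×-dec all? λ j → P? (to j) →-dec (i ≟ j))
  where
  open Inverse e using (to)
  implicit : (∃ λ i → P (to i) × (∀ j → P (to j) → i ≡ j)) → ∃! _≡_ (P ∘ to)
  implicit (i , pᵢ , u) = i , pᵢ , λ {j} → u j
  explicit : ∃! _≡_ (P ∘ to) → ∃ λ i → P (to i) × (∀ j → P (to j) → i ≡ j)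
  explicit (i , pᵢ , u) = i , pᵢ , λ j → u {j}

record Enumerates {I : Set} (xs : List A) (F : I → A) : Set where
  field
    index↔ : Fin (length xs) ↔ I
    lookup-≡ : ∀ j → lookup xs j ≡ F (Inverse.to index↔ j)

  open Inverse index↔ public using (to; from; strictlyInverseˡ)

  lookup-from : ∀ i → lookup xs (from i) ≡ F i
  lookup-from i = trans (lookup-≡ (from i)) (cong F (strictlyInverseˡ i))

  ∈-enumerated⁺ : ∀ i → F i L.∈ xs
  ∈-enumerated⁺ i = subst (L._∈ xs) (lookup-from i) (∈-lookup (from i))

  ∈-enumerated⁻ : ∀ {t} → t L.∈ xs → ∃ λ i → t ≡ F i
  ∈-enumerated⁻ t∈xs = to (index t∈xs) , trans (lookup-index t∈xs) (lookup-≡ (index t∈xs))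

  all-enumerated : (R : I → A → Set) → (∀ i → R i (F i)) → ∀ j → R (to j) (lookup xs j)
  all-enumerated R r j = subst (R (to j)) (sym (lookup-≡ j)) (r (to j))

  exactlyOne-enumerated : (R : I → A → Set) → ∃! _≡_ (λ i → R i (F i)) →
                          ExactlyOne (λ j → R (to j) (lookup xs j))
  exactlyOne-enumerated R =
    ∃!⇒ExactlyOne ∘ ∃!-↔ (↔-sym index↔)
      ∘ ∃!-map (λ {i} → subst (R (to (from i))) (sym (lookup-≡ (from i))))
               (λ {i} → subst (R (to (from i))) (lookup-≡ (from i)))
      ∘ ∃!-map (λ {i} → subst (λ i′ → R i′ (F i′)) (sym (strictlyInverseˡ i)))
               (λ {i} → subst (λ i′ → R i′ (F i′)) (strictlyInverseˡ i))

cast↔ : m ≡ n → Fin m ↔ Fin n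
cast↔ eq = mk↔ₛ′ (cast eq) (cast (sym eq)) (cast-involutive eq (sym eq)) (cast-involutive (sym eq) eq)

tabulate-enumerates : ∀ {A I : Set} {n} (e : Fin n ↔ I) (F : I → A) →
                      Enumerates (tabulate (F ∘ Inverse.to e)) F
tabulate-enumerates {A} {n = n} e F = record
  { index↔ = ↔-trans (cast↔ eq) e
  ; lookup-≡ = λ j → subst (λ j′ → lookup xs j′ ≡ F (Inverse.to e (cast eq j)))
                           (cast-involutive (sym eq) eq j) (lookup-tabulate (F ∘ Inverse.to e) (cast eq j))
  }
  where
  xs : List A
  xs = tabulate (F ∘ Inverse.to e)
  eq : length xs ≡ n
  eq = length-tabulate (F ∘ Inverse.to e)

Triple : ℕ → Set
Triple n = Fin n × Fin n × Fin n

infix 4 _∈ᵗ_ _∈ᵗ?_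

_∈ᵗ_ : Fin n → Triple n → Set
u ∈ᵗ (a , b , c) = u ≡ a ⊎ u ≡ b ⊎ u ≡ c

_∈ᵗ?_ : (u : Fin n) (t : Triple n) → Dec (u ∈ᵗ t)
u ∈ᵗ? (a , b , c) = (u ≟ a) ⊎-dec (u ≟ b) ⊎-dec (u ≟ c)

Distinct : Triple n → Set
Distinct (a , b , c) = a ≢ b × a ≢ c × b ≢ c

distinct? : (t : Triple n) → Dec (Distinct t)
distinct? (a , b , c) = ¬? (a ≟ b) ×-dec ¬? (a ≟ c) ×-dec ¬? (b ≟ c)

mapᵗ : (Fin m → Fin n) → Triple m → Triple n
mapᵗ f (a , b , c) = f a , f b , f c

⟦_⟧ : Triple n → Subset n
⟦ a , b , c ⟧ = ⁅ a ⁆ ∪ (⁅ b ⁆ ∪ ⁅ c ⁆)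

∈⟦⟧⁻ : ∀ {x : Fin n} t → x ∈ ⟦ t ⟧ → x ∈ᵗ t
∈⟦⟧⁻ (a , b , c) x∈t with x∈p∪q⁻ ⁅ a ⁆ _ x∈t
... | inj₁ x∈a = inj₁ (x∈⁅y⁆⇒x≡y a x∈a)
... | inj₂ x∈bc = inj₂ (Sum.map (x∈⁅y⁆⇒x≡y b) (x∈⁅y⁆⇒x≡y c) (x∈p∪q⁻ ⁅ b ⁆ ⁅ c ⁆ x∈bc))

∈⟦⟧⁺ : ∀ {x : Fin n} t → x ∈ᵗ t → x ∈ ⟦ t ⟧
∈⟦⟧⁺ (a , b , c) (inj₁ refl) = x∈p∪q⁺ (inj₁ (x∈⁅x⁆ a))
∈⟦⟧⁺ (a , b , c) (inj₂ (inj₁ refl)) = x∈p∪q⁺ (inj₂ (x∈p∪q⁺ (inj₁ (x∈⁅x⁆ b))))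
∈⟦⟧⁺ (a , b , c) (inj₂ (inj₂ refl)) = x∈p∪q⁺ (inj₂ (x∈p∪q⁺ (inj₂ (x∈⁅x⁆ c))))

∣⁅x⁆∪p∣≡1+∣p∣ : ∀ (x : Fin n) p → x ∉ p → ∣ ⁅ x ⁆ ∪ p ∣ ≡ suc ∣ p ∣
∣⁅x⁆∪p∣≡1+∣p∣ zero (inside ∷ p) x∉p = ⊥-elim (x∉p here)
∣⁅x⁆∪p∣≡1+∣p∣ zero (outside ∷ p) x∉p = cong (suc ∘ ∣_∣) (∪-identityˡ p)
∣⁅x⁆∪p∣≡1+∣p∣ (suc x) (inside ∷ p) x∉p = cong suc (∣⁅x⁆∪p∣≡1+∣p∣ x p (x∉p ∘ there))
∣⁅x⁆∪p∣≡1+∣p∣ (suc x) (outside ∷ p) x∉p = ∣⁅x⁆∪p∣≡1+∣p∣ x p (x∉p ∘ there)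

∣⟦⟧∣≡3 : (t : Triple n) → Distinct t → ∣ ⟦ t ⟧ ∣ ≡ 3
∣⟦⟧∣≡3 (a , b , c) (a≢b , a≢c , b≢c) =
  trans (∣⁅x⁆∪p∣≡1+∣p∣ a _ a∉bc)
        (cong suc (trans (∣⁅x⁆∪p∣≡1+∣p∣ b _ (b≢c ∘ x∈⁅y⁆⇒x≡y c)) (cong suc (∣⁅x⁆∣≡1 c))))
  where
  a∉bc : a ∉ ⁅ b ⁆ ∪ ⁅ c ⁆
  a∉bc a∈bc = [ a≢b ∘ x∈⁅y⁆⇒x≡y b , a≢c ∘ x∈⁅y⁆⇒x≡y c ] (x∈p∪q⁻ ⁅ b ⁆ ⁅ c ⁆ a∈bc)

∈ᵗ-mapᵗ⁺ : ∀ (f : Fin m → Fin n) {u} t → u ∈ᵗ t → f u ∈ᵗ mapᵗ f t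
∈ᵗ-mapᵗ⁺ f t (inj₁ refl) = inj₁ refl
∈ᵗ-mapᵗ⁺ f t (inj₂ (inj₁ refl)) = inj₂ (inj₁ refl)
∈ᵗ-mapᵗ⁺ f t (inj₂ (inj₂ refl)) = inj₂ (inj₂ refl)

∈ᵗ-mapᵗ⁻ : ∀ (f : Fin m → Fin n) {x} t → x ∈ᵗ mapᵗ f t → ∃ λ u → u ∈ᵗ t × x ≡ f u
∈ᵗ-mapᵗ⁻ f (a , b , c) (inj₁ x≡fa) = a , inj₁ refl , x≡fa
∈ᵗ-mapᵗ⁻ f (a , b , c) (inj₂ (inj₁ x≡fb)) = b , inj₂ (inj₁ refl) , x≡fb
∈ᵗ-mapᵗ⁻ f (a , b , c) (inj₂ (inj₂ x≡fc)) = c , inj₂ (inj₂ refl) , x≡fc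

∈ᵗ-mapᵗ-injective : ∀ {f : Fin m → Fin n} → Injective _≡_ _≡_ f → ∀ {u} t → f u ∈ᵗ mapᵗ f t → u ∈ᵗ t
∈ᵗ-mapᵗ-injective f-inj (a , b , c) = Sum.map f-inj (Sum.map f-inj f-inj)

Distinct-mapᵗ : ∀ {f : Fin m → Fin n} → Injective _≡_ _≡_ f → ∀ t → Distinct t → Distinct (mapᵗ f t)
Distinct-mapᵗ f-inj t (a≢b , a≢c , b≢c) = a≢b ∘ f-inj , a≢c ∘ f-inj , b≢c ∘ f-inj

∈⟦mapᵗ⟧⁺ : ∀ (f : Fin m → Fin n) {u} t → u ∈ᵗ t → f u ∈ ⟦ mapᵗ f t ⟧
∈⟦mapᵗ⟧⁺ f t = ∈⟦⟧⁺ (mapᵗ f t) ∘ ∈ᵗ-mapᵗ⁺ f t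

∈⟦mapᵗ⟧⁻ : ∀ {f : Fin m → Fin n} → Injective _≡_ _≡_ f → ∀ {u} t → f u ∈ ⟦ mapᵗ f t ⟧ → u ∈ᵗ t
∈⟦mapᵗ⟧⁻ {f = f} f-inj t = ∈ᵗ-mapᵗ-injective f-inj t ∘ ∈⟦⟧⁻ (mapᵗ f t)

-- The point set of K(Q)

-- inj₁ i stands for the point q_i and inj₂ i for q′_i.
Copy : ℕ → Set
Copy m = Fin m ⊎ Fin m

_≟ᶜ_ : (c c′ : Copy m) → Dec (c ≡ c′)
_≟ᶜ_ = ≡-dec _≟_ _≟_

slot : Copy m → Fin m
slot = reduce

pt : ∀ m → Copy m → Fin (suc (m + m))
pt m c = suc (join m m c)

data PointView (m : ℕ) : Fin (suc (m + m)) → Set where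
  ∞ : PointView m zero
  copy : ∀ c → PointView m (pt m c)

pointView : ∀ m (x : Fin (suc (m + m))) → PointView m x
pointView m zero = ∞
pointView m (suc y) = subst (PointView m ∘ suc) (join-splitAt m m y) (copy (splitAt m y))

join-injective : ∀ m n {c c′ : Fin m ⊎ Fin n} → join m n c ≡ join m n c′ → c ≡ c′
join-injective m n {c} {c′} eq = trans (sym (splitAt-join m n c)) (trans (cong (splitAt m) eq) (splitAt-join m n c′))

pt-injective : ∀ {c c′ : Copy m} → pt m c ≡ pt m c′ → c ≡ c′
pt-injective {m} = join-injective m m ∘ suc-injective

slot-map : ∀ (f : Fin m → Fin n) c → slot (Sum.map f f c) ≡ f (slot c)
slot-map f (inj₁ i) = refl
slot-map f (inj₂ i) = refl

map-injective : ∀ {f : Fin m → Fin n} → Injective _≡_ _≡_ f → Injective _≡_ _≡_ (Sum.map f f)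
map-injective f-inj {inj₁ i} {inj₁ j} eq = cong inj₁ (f-inj (inj₁-injective eq))
map-injective f-inj {inj₂ i} {inj₂ j} eq = cong inj₂ (f-inj (inj₂-injective eq))
map-injective f-inj {inj₁ i} {inj₂ j} ()
map-injective f-inj {inj₂ i} {inj₁ j} ()

double : (Fin m → Fin n) → Fin (suc (m + m)) → Fin (suc (n + n))
double f zero = zero
double {m} {n} f (suc y) = pt n (Sum.map f f (splitAt m y))

double-pt : ∀ (f : Fin m → Fin n) c → double f (pt m c) ≡ pt n (Sum.map f f c)
double-pt {m} {n} f c = cong (pt n ∘ Sum.map f f) (splitAt-join m m c)

∞line : ∀ m → Fin m → Triple (suc (m + m))
∞line m w = ∞pt m , qpt m w , q'pt m w

double-∞line : ∀ (f : Fin m → Fin n) w → mapᵗ (double f) (∞line m w) ≡ ∞line n (f w)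
double-∞line f w = cong₂ (λ x y → zero , x , y) (double-pt f (inj₁ w)) (double-pt f (inj₂ w))

double-injective : ∀ {f : Fin m → Fin n} → Injective _≡_ _≡_ f → Injective _≡_ _≡_ (double f)
double-injective {m} {f = f} f-inj {x} {y} eq with pointView m x | pointView m y
... | ∞ | ∞ = refl
... | copy c | copy c′ =
  cong (pt m) (map-injective f-inj {c} {c′} (pt-injective (trans (sym (double-pt f c)) (trans eq (double-pt f c′)))))
... | ∞ | copy c′ with () ← trans eq (double-pt f c′)
... | copy c | ∞ with () ← trans (sym (double-pt f c)) eq

∈nine⁺ : ∀ (s : Subset n) c → slot c ∈ s → pt n c ∈ nine n s
∈nine⁺ s (inj₁ i) i∈s = there (lookup⇒[]= _ (s ++ s) (trans (lookup-++ˡ s s i) ([]=⇒lookup i∈s)))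
∈nine⁺ s (inj₂ i) i∈s = there (lookup⇒[]= _ (s ++ s) (trans (lookup-++ʳ s s i) ([]=⇒lookup i∈s)))

∈nine⁻ : ∀ (s : Subset n) c → pt n c ∈ nine n s → slot c ∈ s
∈nine⁻ s (inj₁ i) (there h) = lookup⇒[]= i s (trans (sym (lookup-++ˡ s s i)) ([]=⇒lookup h))
∈nine⁻ s (inj₂ i) (there h) = lookup⇒[]= i s (trans (sym (lookup-++ʳ s s i)) ([]=⇒lookup h))

record Labelling (s : Subset n) (k : ℕ) : Set where
  field
    label : Fin k → Fin n
    label-injective : Injective _≡_ _≡_ label
    label-∈ : ∀ i → label i ∈ s
    label-onto : ∀ {x} → x ∈ s → ∃ λ i → label i ≡ x

labelling : (s : Subset n) → Labelling s ∣ s ∣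
labelling [] = record { label = λ () ; label-injective = λ {i} → ⊥-elim (¬Fin0 i) ; label-∈ = λ () ; label-onto = λ () }
labelling (outside ∷ s) = record
  { label = suc ∘ label
  ; label-injective = label-injective ∘ suc-injective
  ; label-∈ = there ∘ label-∈
  ; label-onto = λ { (there x∈s) → Product.map₂ (cong suc) (label-onto x∈s) }
  }
  where open Labelling (labelling s)
labelling (inside ∷ s) = record
  { label = λ { zero → zero ; (suc i) → suc (label i) }
  ; label-injective = λ { {zero} {zero} _ → refl ; {suc i} {suc j} eq → cong suc (label-injective (suc-injective eq)) }
  ; label-∈ = λ { zero → here ; (suc i) → there (label-∈ i) }
  ; label-onto = λ { here → zero , refl ; (there x∈s) → Product.map suc (cong suc) (label-onto x∈s) }
  }
  where open Labelling (labelling s)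

relabel : ∀ {s : Subset n} {k} → Permutation′ k → Labelling s k → Labelling s k
relabel π L = record
  { label = label ∘ (π ⟨$⟩ʳ_)
  ; label-injective = λ eq → trans (sym (inverseˡ π)) (trans (cong (π ⟨$⟩ˡ_) (label-injective eq)) (inverseˡ π))
  ; label-∈ = label-∈ ∘ (π ⟨$⟩ʳ_)
  ; label-onto = λ x∈s → let i , eq = label-onto x∈s in π ⟨$⟩ˡ i , trans (cong label (inverseʳ π)) eq
  }
  where open Labelling L

TailMonochromatic : ∀ {δ} → (Fin n → Fin δ) → (Fin 4 → Fin n) → Set
TailMonochromatic col p = col (p 1F) ≡ col (p 2F) × col (p 2F) ≡ col (p 3F)

tail-balanced-labelling : ∀ {δ} {s : Subset n} (col : Fin n → Fin δ) → ¬ Monochromatic col s →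
                          Labelling s 4 → Σ (Labelling s 4) λ L → ¬ TailMonochromatic col (Labelling.label L)
tail-balanced-labelling {s = s} col ¬mono L
  with col (label 1F) ≟ col (label 2F) | col (label 2F) ≟ col (label 3F)
  where open Labelling L
... | no c₁≢c₂ | _ = L , c₁≢c₂ ∘ proj₁
... | yes _ | no c₂≢c₃ = L , c₂≢c₃ ∘ proj₂
-- If label 1, 2, 3 share a colour then label 0 does not, and swapping 0 and 1 repairs the tail.
... | yes c₁≡c₂ | yes c₂≡c₃ = relabel (transpose 0F 1F) L , λ (c₀≡c₂ , _) → ¬mono (_ , monochromatic c₀≡c₂)
  where
  open Labelling L
  monochromatic : col (label 0F) ≡ col (label 2F) → ∀ x → x ∈ s → col x ≡ col (label 2F)
  monochromatic c₀≡c₂ x x∈s with label-onto x∈s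
  ... | 0F , refl = c₀≡c₂
  ... | 1F , refl = c₁≡c₂
  ... | 2F , refl = refl
  ... | 3F , refl = sym c₂≡c₃

-- AG(2,3) as a Kirkman triple system on nine points

q q′ : Fin 4 → Fin 9
q = qpt 4
q′ = q'pt 4

-- The lines not through ∞: parallel class k consists of ∞line 4 k, affine (k , 0F)
-- and affine (k , 1F).  Only the two lines of class 0 stay inside one copy.
affine : Fin 4 × Fin 2 → Triple 9
affine (0F , 0F) = q 1F , q 2F , q 3F
affine (0F , 1F) = q′ 1F , q′ 2F , q′ 3F
affine (1F , 0F) = q 0F , q 2F , q′ 3F
affine (1F , 1F) = q 3F , q′ 0F , q′ 2F
affine (2F , 0F) = q 1F , q′ 0F , q′ 3F
affine (2F , 1F) = q 0F , q 3F , q′ 1F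
affine (3F , 0F) = q 0F , q 1F , q′ 2F
affine (3F , 1F) = q 2F , q′ 0F , q′ 1F

LineIndex : Set
LineIndex = Fin 4 ⊎ Fin 4 × Fin 2

line : LineIndex → Triple 9
line = [ ∞line 4 , affine ]

parallelClass : LineIndex → Fin 4
parallelClass = [ id , proj₁ ]

affineIndex↔ : Fin 8 ↔ (Fin 4 × Fin 2)
affineIndex↔ = *↔×

lineIndex↔ : Fin 12 ↔ LineIndex
lineIndex↔ = ↔-trans +↔⊎ (↔-refl ⊎-↔ affineIndex↔)

copy↔ : Fin (m + m) ↔ Copy m
copy↔ = +↔⊎

-- Checked by exhaustive computation; opaque so that no use of them re-runs the
-- decision procedures.
opaque
  line-distinct : ∀ i → Distinct (line i)
  line-distinct = toWitness {a? = ∀? lineIndex↔ (distinct? ∘ line)} _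

  line-pairs : ∀ u u′ → u ≢ u′ → ∃! _≡_ (λ i → u ∈ᵗ line i × u′ ∈ᵗ line i)
  line-pairs = toWitness {a? = all? λ u → all? λ u′ → ¬? (u ≟ u′) →-dec
                             ∃!? lineIndex↔ λ i → (u ∈ᵗ? line i) ×-dec (u′ ∈ᵗ? line i)} _

  line-resolution : ∀ k u → ∃! _≡_ (λ i → parallelClass i ≡ k × u ∈ᵗ line i)
  line-resolution = toWitness {a? = all? λ k → all? λ u →
                                  ∃!? lineIndex↔ λ i → (parallelClass i ≟ k) ×-dec (u ∈ᵗ? line i)} _

  ∞∉affine : ∀ a → ¬ (∞pt 4 ∈ᵗ affine a)
  ∞∉affine = toWitness {a? = ∀? affineIndex↔ λ a → ¬? (∞pt 4 ∈ᵗ? affine a)} _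

  affine-slot-injective : ∀ a c c′ → pt 4 c ∈ᵗ affine a → pt 4 c′ ∈ᵗ affine a → slot c ≡ slot c′ → c ≡ c′
  affine-slot-injective = toWitness {a? = ∀? affineIndex↔ λ a → ∀? copy↔ λ c → ∀? copy↔ λ c′ →
    (pt 4 c ∈ᵗ? affine a) →-dec (pt 4 c′ ∈ᵗ? affine a) →-dec (slot c ≟ slot c′) →-dec (c ≟ᶜ c′)} _

  affine-avoids-own-slot : ∀ a c → pt 4 c ∈ᵗ affine a → slot c ≢ proj₁ a
  affine-avoids-own-slot = toWitness {a? = ∀? affineIndex↔ λ a → ∀? copy↔ λ c →
    (pt 4 c ∈ᵗ? affine a) →-dec ¬? (slot c ≟ proj₁ a)} _

  affine-covers : ∀ k c → slot c ≢ k → ∃! _≡_ (λ j → pt 4 c ∈ᵗ affine (k , j))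
  affine-covers = toWitness {a? = all? λ k → ∀? copy↔ λ c →
    ¬? (slot c ≟ k) →-dec ∃!? ↔-refl λ j → pt 4 c ∈ᵗ? affine (k , j)} _

  affine-pairs : ∀ c c′ → slot c ≢ slot c′ → ∃! _≡_ (λ a → pt 4 c ∈ᵗ affine a × pt 4 c′ ∈ᵗ affine a)
  affine-pairs = toWitness {a? = ∀? copy↔ λ c → ∀? copy↔ λ c′ → ¬? (slot c ≟ slot c′) →-dec
    ∃!? affineIndex↔ λ a → (pt 4 c ∈ᵗ? affine a) ×-dec (pt 4 c′ ∈ᵗ? affine a)} _

  affine-mixed : ∀ k j → ∃ λ a → ∃ λ a′ → q a ∈ᵗ affine (suc k , j) × q′ a′ ∈ᵗ affine (suc k , j)
  affine-mixed = toWitness {a? = all? λ k → all? λ j → any? λ a → any? λ a′ →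
    (q a ∈ᵗ? affine (suc k , j)) ×-dec (q′ a′ ∈ᵗ? affine (suc k , j))} _

-- Gluing the blocks

module Construction {v : ℕ} {QB : List (Subset v)} (isQS : IsQS v QB)
                    -- needed only to find a block through every point
                    (another : (w : Fin v) → ∃ λ w′ → w′ ≢ w)
                    (lab : ∀ b → Labelling (lookup QB b) 4) where

  open IsDesignOn isQS using (pairs)

  N : ℕ
  N = suc (v + v)

  Block : Set
  Block = Fin (length QB)

  block : Block → Subset v
  block = lookup QB

  module _ (b : Block) where
    open Labelling (lab b) public
      renaming (label to p; label-injective to p-injective; label-∈ to p-∈; label-onto to p-onto)

  φ : Block → Fin 9 → Fin N
  φ b = double (p b)

  localTriple : Block → LineIndex → Subset N
  localTriple b i = ⟦ mapᵗ (φ b) (line i) ⟧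

  TripleIndex : Set
  TripleIndex = Fin v ⊎ Block × (Fin 4 × Fin 2)

  triple : TripleIndex → Subset N
  triple (inj₁ w) = ∞triple v w
  triple (inj₂ (b , a)) = localTriple b (inj₂ a)

  class : TripleIndex → Fin v
  class (inj₁ w) = w
  class (inj₂ (b , k , _)) = p b k

  localTriple-∞line : ∀ b k → localTriple b (inj₁ k) ≡ ∞triple v (p b k)
  localTriple-∞line b k = cong ⟦_⟧ (double-∞line (p b) k)

  block-through : ∀ {i j} → i ≢ j → ∃! _≡_ (λ b → i ∈ block b × j ∈ block b)
  block-through i≢j = let b , i∈b , unique = pairs _ _ ∈⊤ ∈⊤ i≢j in b , i∈b , λ h → sym (unique _ h)

  block-containing : ∀ w → ∃ λ b → w ∈ block b
  block-containing w with another w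
  ... | w′ , w′≢w with block-through (w′≢w ∘ sym)
  ... | b , (w∈b , _) , _ = b , w∈b

  lift : Block → Copy 4 → Copy v
  lift b = Sum.map (p b) (p b)

  slot-lift : ∀ b c₁ → slot (lift b c₁) ≡ p b (slot c₁)
  slot-lift b = slot-map (p b)

  lift-slot : ∀ b c₁ {c} → lift b c₁ ≡ c → p b (slot c₁) ≡ slot c
  lift-slot b c₁ eq = trans (sym (slot-lift b c₁)) (cong slot eq)

  lift-onto : ∀ b c → slot c ∈ block b → ∃ λ c₁ → lift b c₁ ≡ c
  lift-onto b (inj₁ i) i∈b = Product.map inj₁ (cong inj₁) (p-onto b i∈b)
  lift-onto b (inj₂ i) i∈b = Product.map inj₂ (cong inj₂) (p-onto b i∈b)

  ∈blockTriple⁺ : ∀ b a c₁ → pt 4 c₁ ∈ᵗ affine a → pt v (lift b c₁) ∈ triple (inj₂ (b , a))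
  ∈blockTriple⁺ b a c₁ h = subst (_∈ triple (inj₂ (b , a))) (double-pt (p b) c₁) (∈⟦mapᵗ⟧⁺ (φ b) (affine a) h)

  ∈blockTriple⁻ : ∀ b a {x} → x ∈ triple (inj₂ (b , a)) → ∃ λ c₁ → pt 4 c₁ ∈ᵗ affine a × x ≡ pt v (lift b c₁)
  ∈blockTriple⁻ b a x∈t with ∈ᵗ-mapᵗ⁻ (φ b) (affine a) (∈⟦⟧⁻ _ x∈t)
  ... | u , u∈a , x≡φu with pointView 4 u
  ... | ∞ = ⊥-elim (∞∉affine a u∈a)
  ... | copy c₁ = c₁ , u∈a , trans x≡φu (double-pt (p b) c₁)

  ∞∉blockTriple : ∀ b a → zero ∉ triple (inj₂ (b , a))
  ∞∉blockTriple b a h with ∈blockTriple⁻ b a h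
  ... | _ , _ , ()

  pt∈blockTriple⁻ : ∀ b a {c} → pt v c ∈ triple (inj₂ (b , a)) → ∃ λ c₁ → pt 4 c₁ ∈ᵗ affine a × lift b c₁ ≡ c
  pt∈blockTriple⁻ b a {c} h =
    let c₁ , c₁∈a , eq = ∈blockTriple⁻ b a h in c₁ , c₁∈a , sym (pt-injective {c = c} {c′ = lift b c₁} eq)

  slot∈block : ∀ b a {c} → pt v c ∈ triple (inj₂ (b , a)) → slot c ∈ block b
  slot∈block b a {c} h =
    let c₁ , _ , eq = pt∈blockTriple⁻ b a {c} h in subst (_∈ block b) (lift-slot b c₁ eq) (p-∈ b (slot c₁))

  ∞∈∞triple : ∀ w → zero ∈ ∞triple v w
  ∞∈∞triple w = ∈⟦⟧⁺ (∞line v w) (inj₁ refl)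

  ∈∞triple⁺ : ∀ {w} c → slot c ≡ w → pt v c ∈ ∞triple v w
  ∈∞triple⁺ (inj₁ i) refl = ∈⟦⟧⁺ (∞line v i) (inj₂ (inj₁ refl))
  ∈∞triple⁺ (inj₂ i) refl = ∈⟦⟧⁺ (∞line v i) (inj₂ (inj₂ refl))

  ∈∞triple⁻ : ∀ {w c} → pt v c ∈ ∞triple v w → slot c ≡ w
  ∈∞triple⁻ {w} {c} h with ∈⟦⟧⁻ (∞line v w) h
  ... | inj₂ (inj₁ eq) = cong slot (pt-injective {c = c} {c′ = inj₁ w} eq)
  ... | inj₂ (inj₂ eq) = cong slot (pt-injective {c = c} {c′ = inj₂ w} eq)

  ∈blockTriple-lift⁻ : ∀ b a c₁ → pt v (lift b c₁) ∈ triple (inj₂ (b , a)) → pt 4 c₁ ∈ᵗ affine a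
  ∈blockTriple-lift⁻ b a c₁ h =
    let c₁′ , c₁′∈a , eq = pt∈blockTriple⁻ b a {lift b c₁} h
    in subst (λ c → pt 4 c ∈ᵗ affine a) (map-injective (p-injective b) {c₁′} {c₁} eq) c₁′∈a

  blockTriple-slot-injective : ∀ b a {c c′} → pt v c ∈ triple (inj₂ (b , a)) → pt v c′ ∈ triple (inj₂ (b , a)) →
                               slot c ≡ slot c′ → c ≡ c′
  blockTriple-slot-injective b a {c} {c′} h h′ same =
    let c₁ , c₁∈a , eq₁ = pt∈blockTriple⁻ b a {c} h
        c₂ , c₂∈a , eq₂ = pt∈blockTriple⁻ b a {c′} h′
        same₁₂ = p-injective b (trans (lift-slot b c₁ eq₁) (trans same (sym (lift-slot b c₂ eq₂))))
    in trans (sym eq₁) (trans (cong (lift b) (affine-slot-injective a c₁ c₂ c₁∈a c₂∈a same₁₂)) eq₂)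

  pairs-∞ : ∀ c → ∃! _≡_ (λ t → zero ∈ triple t × pt v c ∈ triple t)
  pairs-∞ c = inj₁ (slot c) , (∞∈∞triple (slot c) , ∈∞triple⁺ c refl) , unique
    where
    unique : ∀ {t} → zero ∈ triple t × pt v c ∈ triple t → inj₁ (slot c) ≡ t
    unique {inj₁ w} (_ , h) = cong inj₁ (∈∞triple⁻ {c = c} h)
    unique {inj₂ (b , a)} (h , _) = ⊥-elim (∞∉blockTriple b a h)

  pairs-same-slot : ∀ c c′ → c ≢ c′ → slot c ≡ slot c′ →
                    ∃! _≡_ (λ t → pt v c ∈ triple t × pt v c′ ∈ triple t)
  pairs-same-slot c c′ c≢c′ same = inj₁ (slot c) , (∈∞triple⁺ c refl , ∈∞triple⁺ c′ (sym same)) , unique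
    where
    unique : ∀ {t} → pt v c ∈ triple t × pt v c′ ∈ triple t → inj₁ (slot c) ≡ t
    unique {inj₁ w} (h , _) = cong inj₁ (∈∞triple⁻ {c = c} h)
    unique {inj₂ (b , a)} (h , h′) = ⊥-elim (c≢c′ (blockTriple-slot-injective b a h h′ same))

  pairs-distinct-slots : ∀ c c′ → slot c ≢ slot c′ →
                         ∃! _≡_ (λ t → pt v c ∈ triple t × pt v c′ ∈ triple t)
  pairs-distinct-slots c c′ differ with block-through differ
  ... | b , (c∈b , c′∈b) , unique-b with lift-onto b c c∈b | lift-onto b c′ c′∈b
  ... | c₁ , refl | c₂ , refl
    with affine-pairs c₁ c₂ (λ eq → differ (trans (slot-lift b c₁) (trans (cong (p b) eq) (sym (slot-lift b c₂)))))
  ... | a , (c₁∈a , c₂∈a) , unique-a = inj₂ (b , a) , (∈blockTriple⁺ b a c₁ c₁∈a , ∈blockTriple⁺ b a c₂ c₂∈a) , unique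
    where
    unique : ∀ {t} → pt v (lift b c₁) ∈ triple t × pt v (lift b c₂) ∈ triple t → inj₂ (b , a) ≡ t
    unique {inj₁ w} (h , h′) = ⊥-elim (differ (trans (∈∞triple⁻ {c = lift b c₁} h) (sym (∈∞triple⁻ {c = lift b c₂} h′))))
    unique {inj₂ (b′ , a′)} (h , h′) with unique-b (slot∈block b′ a′ {lift b c₁} h , slot∈block b′ a′ {lift b c₂} h′)
    ... | refl = cong (λ a″ → inj₂ (b , a″)) (unique-a (∈blockTriple-lift⁻ b a′ c₁ h , ∈blockTriple-lift⁻ b a′ c₂ h′))

  resolution-∞ : ∀ r → ∃! _≡_ (λ t → class t ≡ r × zero ∈ triple t)
  resolution-∞ r = inj₁ r , (refl , ∞∈∞triple r) , unique
    where
    unique : ∀ {t} → class t ≡ r × zero ∈ triple t → inj₁ r ≡ t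
    unique {inj₁ w} (refl , _) = refl
    unique {inj₂ (b , a)} (_ , h) = ⊥-elim (∞∉blockTriple b a h)

  resolution-own-slot : ∀ c → ∃! _≡_ (λ t → class t ≡ slot c × pt v c ∈ triple t)
  resolution-own-slot c = inj₁ (slot c) , (refl , ∈∞triple⁺ c refl) , unique
    where
    unique : ∀ {t} → class t ≡ slot c × pt v c ∈ triple t → inj₁ (slot c) ≡ t
    unique {inj₁ w} (refl , _) = refl
    unique {inj₂ (b , a)} (eq , h) =
      let c₁ , c₁∈a , lift≡c = pt∈blockTriple⁻ b a {c} h
      in ⊥-elim (affine-avoids-own-slot a c₁ c₁∈a (p-injective b (trans (lift-slot b c₁ lift≡c) (sym eq))))

  resolution-other-slot : ∀ r c → slot c ≢ r → ∃! _≡_ (λ t → class t ≡ r × pt v c ∈ triple t)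
  resolution-other-slot r c differ with block-through differ
  ... | b , (c∈b , r∈b) , unique-b with lift-onto b c c∈b | p-onto b r∈b
  ... | c₁ , refl | k , refl with affine-covers k c₁ (differ ∘ trans (slot-lift b c₁) ∘ cong (p b))
  ... | j , c₁∈kj , unique-j = inj₂ (b , k , j) , (refl , ∈blockTriple⁺ b (k , j) c₁ c₁∈kj) , unique
    where
    unique : ∀ {t} → class t ≡ p b k × pt v (lift b c₁) ∈ triple t → inj₂ (b , k , j) ≡ t
    unique {inj₁ w} (refl , h) = ⊥-elim (differ (∈∞triple⁻ {c = lift b c₁} h))
    unique {inj₂ (b′ , k′ , j′)} (eq , h)
      with unique-b (slot∈block b′ (k′ , j′) {lift b c₁} h , subst (_∈ block b′) eq (p-∈ b′ k′))
    ... | refl with p-injective b eq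
    ... | refl = cong (λ j″ → inj₂ (b , k , j″)) (unique-j (∈blockTriple-lift⁻ b (k , j′) c₁ h))

  triple-pairs : ∀ x y → x ≢ y → ∃! _≡_ (λ t → x ∈ triple t × y ∈ triple t)
  triple-pairs x y x≢y with pointView v x | pointView v y
  ... | ∞ | ∞ = ⊥-elim (x≢y refl)
  ... | ∞ | copy c = pairs-∞ c
  ... | copy c | ∞ = ∃!-map Product.swap Product.swap (pairs-∞ c)
  ... | copy c | copy c′ with slot c ≟ slot c′
  ... | yes same = pairs-same-slot c c′ (x≢y ∘ cong (pt v)) same
  ... | no differ = pairs-distinct-slots c c′ differ

  triple-resolution : ∀ r x → ∃! _≡_ (λ t → class t ≡ r × x ∈ triple t)
  triple-resolution r x with pointView v x
  ... | ∞ = resolution-∞ r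
  ... | copy c with slot c ≟ r
  ... | yes refl = resolution-own-slot c
  ... | no differ = resolution-other-slot r c differ

  tripleIndex↔ : Fin (v + length QB * 8) ↔ TripleIndex
  tripleIndex↔ = ↔-trans +↔⊎ (↔-refl ⊎-↔ ↔-trans *↔× (↔-refl ×-↔ affineIndex↔))

  T : List (Subset N)
  T = tabulate (triple ∘ Inverse.to tripleIndex↔)

  module T = Enumerates (tabulate-enumerates tripleIndex↔ triple)

  localTriples : Block → List (Subset N)
  localTriples b = tabulate (localTriple b ∘ Inverse.to lineIndex↔)

  module Local (b : Block) = Enumerates (tabulate-enumerates lineIndex↔ (localTriple b))

  ∣localTriple∣≡3 : ∀ b i → ∣ localTriple b i ∣ ≡ 3
  ∣localTriple∣≡3 b i = ∣⟦⟧∣≡3 _ (Distinct-mapᵗ (double-injective (p-injective b)) (line i) (line-distinct i))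

  ∣triple∣≡3 : ∀ t → ∣ triple t ∣ ≡ 3
  ∣triple∣≡3 (inj₁ w) = ∣⟦⟧∣≡3 (∞line v w) ((λ ()) , (λ ()) , q≢q′)
    where
    q≢q′ : qpt v w ≢ q'pt v w
    q≢q′ eq with pt-injective {c = inj₁ w} {c′ = inj₂ w} eq
    ... | ()
  ∣triple∣≡3 (inj₂ (b , a)) = ∣localTriple∣≡3 b (inj₂ a)

  T-isKTS : IsKTS N T
  T-isKTS =
    record { blockSize = T.all-enumerated (λ _ t → ∣ t ∣ ≡ 3) ∣triple∣≡3
           ; blockInS = λ _ _ → ∈⊤
           ; pairs = λ x y _ _ x≢y → T.exactlyOne-enumerated (λ _ t → x ∈ t × y ∈ t) (triple-pairs x y x≢y)
           }
    , v , class ∘ T.to , λ r x _ → T.exactlyOne-enumerated (λ i t → class i ≡ r × x ∈ t) (triple-resolution r x)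

  φ-∈nine : ∀ b u → φ b u ∈ nine v (block b)
  φ-∈nine b u with pointView 4 u
  ... | ∞ = here
  ... | copy c₁ = subst (_∈ nine v (block b)) (sym (double-pt (p b) c₁))
                    (∈nine⁺ (block b) (lift b c₁) (subst (_∈ block b) (sym (slot-lift b c₁)) (p-∈ b (slot c₁))))

  nine-φ-onto : ∀ b {x} → x ∈ nine v (block b) → ∃ λ u → φ b u ≡ x
  nine-φ-onto b {x} x∈nine with pointView v x
  ... | ∞ = zero , refl
  ... | copy c with lift-onto b c (∈nine⁻ (block b) c x∈nine)
  ... | c₁ , refl = pt 4 c₁ , double-pt (p b) c₁

  localTriples-KTS : ∀ b → IsKTSOn (nine v (block b)) (localTriples b)
  localTriples-KTS b =
    record { blockSize = all-enumerated (λ _ t → ∣ t ∣ ≡ 3) (∣localTriple∣≡3 b)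
           ; blockInS = all-enumerated (λ _ t → t ⊆ nine v (block b)) localTriple⊆nine
           ; pairs = local-pairs
           }
    , 4 , parallelClass ∘ to , local-resolution
    where
    open Local b
    φ-injective : Injective _≡_ _≡_ (φ b)
    φ-injective = double-injective (p-injective b)

    localTriple⊆nine : ∀ i → localTriple b i ⊆ nine v (block b)
    localTriple⊆nine i x∈t with ∈ᵗ-mapᵗ⁻ (φ b) (line i) (∈⟦⟧⁻ _ x∈t)
    ... | u , _ , refl = φ-∈nine b u

    local-pairs : ∀ x y → x ∈ nine v (block b) → y ∈ nine v (block b) → x ≢ y →
                  ExactlyOne (λ j → x ∈ lookup (localTriples b) j × y ∈ lookup (localTriples b) j)
    local-pairs x y x∈nine y∈nine x≢y with nine-φ-onto b x∈nine | nine-φ-onto b y∈nine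
    ... | u , refl | u′ , refl =
      exactlyOne-enumerated (λ _ t → φ b u ∈ t × φ b u′ ∈ t)
        (∃!-map (λ {i} → Product.map (∈⟦mapᵗ⟧⁺ (φ b) (line i)) (∈⟦mapᵗ⟧⁺ (φ b) (line i)))
                (λ {i} → Product.map (∈⟦mapᵗ⟧⁻ φ-injective (line i)) (∈⟦mapᵗ⟧⁻ φ-injective (line i)))
                (line-pairs u u′ (x≢y ∘ cong (φ b))))

    local-resolution : ∀ k x → x ∈ nine v (block b) →
                       ExactlyOne (λ j → parallelClass (to j) ≡ k × x ∈ lookup (localTriples b) j)
    local-resolution k x x∈nine with nine-φ-onto b x∈nine
    ... | u , refl =
      exactlyOne-enumerated (λ i t → parallelClass i ≡ k × φ b u ∈ t)
        (∃!-map (λ {i} → Product.map₂ (∈⟦mapᵗ⟧⁺ (φ b) (line i)))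
                (λ {i} → Product.map₂ (∈⟦mapᵗ⟧⁻ φ-injective (line i)))
                (line-resolution k u))

  ∞triple∈localTriples : ∀ b w → w ∈ block b → ∞triple v w L.∈ localTriples b
  ∞triple∈localTriples b w w∈b with p-onto b w∈b
  ... | k , refl = subst (L._∈ localTriples b) (localTriple-∞line b k) (Local.∈-enumerated⁺ b (inj₁ k))

  localTriple-through-∞ : ∀ b t → t L.∈ localTriples b → ∞pt v ∈ t → ∃ λ w → w ∈ block b × t ≡ ∞triple v w
  localTriple-through-∞ b t t∈ ∞∈t with Local.∈-enumerated⁻ b t∈
  ... | inj₁ k , refl = p b k , p-∈ b k , localTriple-∞line b k
  ... | inj₂ a , refl = ⊥-elim (∞∉blockTriple b a ∞∈t)

  T-from-localTriples : ∀ t → t L.∈ T ⇔ ∃ λ b → t L.∈ localTriples b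
  T-from-localTriples t = mk⇔ to from
    where
    to : t L.∈ T → ∃ λ b → t L.∈ localTriples b
    to t∈T with T.∈-enumerated⁻ t∈T
    ... | inj₁ w , refl = let b , w∈b = block-containing w in b , ∞triple∈localTriples b w w∈b
    ... | inj₂ (b , a) , refl = b , Local.∈-enumerated⁺ b (inj₂ a)
    from : (∃ λ b → t L.∈ localTriples b) → t L.∈ T
    from (b , t∈) with Local.∈-enumerated⁻ b t∈
    ... | inj₁ k , refl = subst (L._∈ T) (sym (localTriple-∞line b k)) (T.∈-enumerated⁺ (inj₁ (p b k)))
    ... | inj₂ a , refl = T.∈-enumerated⁺ (inj₂ (b , a))

  T-isKQ : IsKQ v QB T
  T-isKQ = localTriples
         , (λ b → localTriples-KTS b , ∞triple∈localTriples b , localTriple-through-∞ b)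
         , T-from-localTriples

  -- Every triple through ∞ meets both copies, so c∞ is arbitrary.
  module Colouring {δ : ℕ} (col : Fin v → Fin δ) (c∞ : Fin (2 * δ))
                   (balanced : ∀ b → ¬ TailMonochromatic col (p b)) where

    -- 2 * δ unfolds to δ + (δ + 0): the first palette on the left, the second on the right.
    embed : Fin δ ⊎ Fin δ → Fin (2 * δ)
    embed = join δ (δ + 0) ∘ Sum.map id (_↑ˡ 0)

    embed-injective : ∀ {c c′} → embed c ≡ embed c′ → c ≡ c′
    embed-injective {c} {c′} eq = halves (join-injective δ (δ + 0) {Sum.map id (_↑ˡ 0) c} {Sum.map id (_↑ˡ 0) c′} eq)
      where
      halves : ∀ {c c′} → Sum.map id (_↑ˡ 0) c ≡ Sum.map id (_↑ˡ 0) c′ → c ≡ c′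
      halves {inj₁ a} {inj₁ a′} refl = refl
      halves {inj₂ a} {inj₂ a′} eq = cong inj₂ (↑ˡ-injective 0 a a′ (inj₂-injective eq))
      halves {inj₁ _} {inj₂ _} ()
      halves {inj₂ _} {inj₁ _} ()

    colour : Fin N → Fin (2 * δ)
    colour zero = c∞
    colour (suc y) = embed (Sum.map col col (splitAt v y))

    colour-pt : ∀ c → colour (pt v c) ≡ embed (Sum.map col col c)
    colour-pt c = cong (embed ∘ Sum.map col col) (splitAt-join v v c)

    colour-slot : ∀ c c′ → colour (pt v c) ≡ colour (pt v c′) → col (slot c) ≡ col (slot c′)
    colour-slot c c′ eq =
      let same-map = embed-injective {Sum.map col col c} {Sum.map col col c′} (trans (sym (colour-pt c)) (trans eq (colour-pt c′)))
      in trans (sym (slot-map col c)) (trans (cong slot same-map) (slot-map col c′))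

    halves-differ : ∀ a a′ → colour (pt v (inj₁ a)) ≢ colour (pt v (inj₂ a′))
    halves-differ a a′ eq
      with embed-injective {inj₁ (col a)} {inj₂ (col a′)} (trans (sym (colour-pt (inj₁ a))) (trans eq (colour-pt (inj₂ a′))))
    ... | ()

    ¬monochromatic : ∀ {t x y} → x ∈ t → y ∈ t → colour x ≢ colour y → ¬ Monochromatic colour t
    ¬monochromatic {x = x} {y} x∈t y∈t differ (_ , mono) = differ (trans (mono x x∈t) (sym (mono y y∈t)))

    ¬monochromatic-tail : ∀ b a (side : Fin 4 → Copy 4) → (∀ i → slot (side i) ≡ i) →
                          pt 4 (side 1F) ∈ᵗ affine a → pt 4 (side 2F) ∈ᵗ affine a → pt 4 (side 3F) ∈ᵗ affine a →
                          ¬ Monochromatic colour (triple (inj₂ (b , a)))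
    ¬monochromatic-tail b a side slot-side m₁ m₂ m₃ (_ , mono) = balanced b (same 1F 2F m₁ m₂ , same 2F 3F m₂ m₃)
      where
      slot-side-lift : ∀ i → slot (lift b (side i)) ≡ p b i
      slot-side-lift i = trans (slot-lift b (side i)) (cong (p b) (slot-side i))
      same : ∀ i i′ → pt 4 (side i) ∈ᵗ affine a → pt 4 (side i′) ∈ᵗ affine a → col (p b i) ≡ col (p b i′)
      same i i′ m m′ =
        let c = lift b (side i); c′ = lift b (side i′)
            same-colour = trans (mono (pt v c) (∈blockTriple⁺ b a (side i) m)) (sym (mono (pt v c′) (∈blockTriple⁺ b a (side i′) m′)))
        in trans (cong col (sym (slot-side-lift i))) (trans (colour-slot c c′ same-colour) (cong col (slot-side-lift i′)))

    triple-not-monochromatic : ∀ t → ¬ Monochromatic colour (triple t)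
    triple-not-monochromatic (inj₁ w) =
      ¬monochromatic (∈∞triple⁺ (inj₁ w) refl) (∈∞triple⁺ (inj₂ w) refl) (halves-differ w w)
    triple-not-monochromatic (inj₂ (b , 0F , 0F)) =
      ¬monochromatic-tail b (0F , 0F) inj₁ (λ _ → refl) (inj₁ refl) (inj₂ (inj₁ refl)) (inj₂ (inj₂ refl))
    triple-not-monochromatic (inj₂ (b , 0F , 1F)) =
      ¬monochromatic-tail b (0F , 1F) inj₂ (λ _ → refl) (inj₁ refl) (inj₂ (inj₁ refl)) (inj₂ (inj₂ refl))
    triple-not-monochromatic (inj₂ (b , suc k , j)) =
      let a , a′ , m , m′ = affine-mixed k j
      in ¬monochromatic (∈blockTriple⁺ b (suc k , j) (inj₁ a) m) (∈blockTriple⁺ b (suc k , j) (inj₂ a′) m′)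
                        (halves-differ (p b a) (p b a′))

    T-colourable : Colourable (2 * δ) T
    T-colourable = colour , T.all-enumerated (λ _ t → ¬ Monochromatic colour t) triple-not-monochromatic

another-point : ∀ {n} (w : Fin (suc (suc n))) → ∃ λ w′ → w′ ≢ w
another-point zero = 1F , λ ()
another-point (suc _) = 0F , λ ()

theorem6p3 : ∀ (δ v : ℕ) → 2 ≤ δ → 2 ≤ v →
    (QB : List (Subset v)) → IsQS v QB → Colourable δ QB →
    ∃ (λ (T : List (Subset (suc (v + v)))) →
      IsKQ v QB T × IsKTS (suc (v + v)) T × Colourable (2 * δ) T)
theorem6p3 (suc δ) (suc (suc n)) (s≤s _) (s≤s (s≤s _)) QB isQS (col , ¬mono) =
  T , T-isKQ , T-isKTS , T-colourable
  where
  open IsDesignOn isQS using (blockSize)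

  balanced : ∀ b → Σ (Labelling (lookup QB b) 4) λ L → ¬ TailMonochromatic col (Labelling.label L)
  balanced b = tail-balanced-labelling col (¬mono b)
                 (subst (Labelling (lookup QB b)) (blockSize b) (labelling (lookup QB b)))

  open Construction isQS another-point (proj₁ ∘ balanced)
  open Colouring col 0F (proj₂ ∘ balanced)
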